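{- As $\mathbb{L}$-species, $\mathrm{Cay}(112) = \mathrm{Alt}'$. Equivalently, for every $n\ge 0$ the number of Cayley permutations of length $n$ avoiding the pattern $112$ equals the number of even permutations of an $(n+1)$-element set.
   Context: A Cayley permutation of length $n$ is a word $w=w_1\cdots w_n$ of positive integers such that $\{w_1,\dots,w_n\}=[k]=\{1,\dots,k\}$ for some $k\le n$ (the empty word is the unique one of length $0$). A word $w$ contains a Cayley permutation $p=p_1\cdots p_k$ if some subsequence $w_{i_1}\cdots w_{i_k}$ with $i_1<\cdots<i_k$ is order isomorphic to $p$ (for all $a,b$: $w_{i_a}<w_{i_b}\iff p_a<p_b$ and $w_{i_a}=w_{i_b}\iff p_a=p_b$); otherwise $w$ avoids $p$. An $\mathbb{L}$-species $F$ assigns to each finite totally ordered set $\ell$ a finite set $F[\ell]$, functorially with respect to order-preserving bijections; since such bijections are unique, two $\mathbb{L}$-species are isomorphic (written $F=G$) iff $|F[n]|=|G[n]|$ for all $n$, where $F[n]=F[\{1<\cdots<n\}]$. $\mathrm{Cay}(p)$ is the $\mathbb{L}$-species whose structures on $[n]$ are the $p$-avoiding Cayley permutations of length $n$. $\mathrm{Alt}$ is the species of even permutations (structures on $\ell$ are the even bijections $\ell\to\ell$). The derivative is $F'[\ell]=F[1\oplus\ell]$, where $1\oplus\ell$ is $\ell$ with a new minimum element adjoined. -}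

module Defs where

open import Level using (0ℓ)
open import Data.Nat using (ℕ; zero; suc; _≤_; _<_; _+_)
open import Data.Nat.Divisibility using (_∣_)
open import Data.Fin as Fin using (Fin)
open import Data.Vec using (Vec; lookup; [])
open import Data.List using (List; []; _∷_; length; filter; allFin; concatMap; map)
open import Data.Product using (Σ; ∃; _×_; _,_; proj₁)
open import Function.Bundles using (_⇔_; Inverse)
open import Relation.Binary.Bundles using (Setoid)
open import Relation.Binary.PropositionalEquality using (_≡_; refl; sym; trans)
open import Data.Fin.Permutation using (Permutation′; _⟨$⟩ʳ_)
open import Relation.Nullary using (¬_)

IsCayley : ∀ {n} → Vec ℕ n → Set
IsCayley {n} w =
  Σ ℕ λ k → k ≤ n
          × (∀ i → 1 ≤ lookup w i × lookup w i ≤ k)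
          × (∀ j → 1 ≤ j → j ≤ k → ∃ λ i → lookup w i ≡ j)

Contains : ∀ {n k} → Vec ℕ n → Vec ℕ k → Set
Contains {n} {k} w p =
  Σ (Fin k → Fin n) λ f →
      (∀ a b → a Fin.< b → f a Fin.< f b)
    × (∀ a b → (lookup w (f a) < lookup w (f b) ⇔ lookup p a < lookup p b)
             × (lookup w (f a) ≡ lookup w (f b) ⇔ lookup p a ≡ lookup p b))

Avoids : ∀ {n k} → Vec ℕ n → Vec ℕ k → Set
Avoids w p = ¬ Contains w p

p112 : Vec ℕ 3
p112 = 1 Data.Vec.∷ 1 Data.Vec.∷ 2 Data.Vec.∷ []

Cay : ∀ {k} → Vec ℕ k → ℕ → Setoid 0ℓ 0ℓ
Cay p n = record
  { Carrier = Σ (Vec ℕ n) (λ w → IsCayley w × Avoids w p)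
  ; _≈_ = λ x y → proj₁ x ≡ proj₁ y
  ; isEquivalence = record { refl = refl ; sym = sym ; trans = trans }
  }

inversions : ∀ {m} → Permutation′ m → ℕ
inversions {m} π =
  length (concatMap (λ i → filter (λ j → (i Fin.<? j) ×-dec ((π ⟨$⟩ʳ j) Fin.<? (π ⟨$⟩ʳ i)))
                                   (allFin m))
                    (allFin m))
  where open import Relation.Nullary.Decidable using (_×-dec_)

IsEven : ∀ {m} → Permutation′ m → Set
IsEven π = 2 ∣ inversions π

Alt : ℕ → Setoid 0ℓ 0ℓ
Alt m = record
  { Carrier = Σ (Permutation′ m) IsEven
  ; _≈_ = λ x y → ∀ i → proj₁ x ⟨$⟩ʳ i ≡ proj₁ y ⟨$⟩ʳ i
  ; isEquivalence = record
      { refl = λ i → refl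
      ; sym = λ e i → sym (e i)
      ; trans = λ e f i → trans (e i) (f i) }
  }

-- Derivative of an L-species: F'[n] = F[1 ⊕ [n]], which has n+1 elements.
Alt′ : ℕ → Setoid 0ℓ 0ℓ
Alt′ n = Alt (suc n)

-- Both sides are in bijection with Code n, the sequences of n choices in which the choice
-- made at size m ranges over m + 1 values, plus one further value once m ≥ 1.
-- A 112-avoiding Cayley permutation of length m + 1 either ends in a 1 that is not its
-- only 1, and dropping that last letter leaves one of length m; or its 1 is unique (after a
-- second 1 every letter must be 1), and deleting it and lowering the other letters leaves
-- one of length m, the 1 having had any of m + 1 positions.
-- An even permutation π of m + 2 points is determined by π 0, one of m + 2 values, and the
-- permutation of the remaining points, whose parity is then fixed because 0 takes part in
-- exactly toℕ (π 0) inversions; on two points the parity alone determines the permutation.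
module Submission where

open import Defs
open import Algebra.Properties.Group using (\\-leftDividesˡ)
open import Data.Bool using (Bool; true; false; _∧_; if_then_else_)
open import Data.Empty using (⊥; ⊥-elim)
open import Data.Fin as Fin using (Fin; zero; suc; toℕ; fromℕ; punchIn; punchOut)
import Data.Fin.Properties as Finₚ
open import Data.Fin.Permutation as Perm
  using (Permutation′; _⟨$⟩ʳ_; remove; insert; insert-remove; remove-insert; punchIn-permute)
open import Data.List using (List; length; filter; tabulate; concatMap; allFin)
open import Data.List.Properties using (length-++)
open import Data.Nat as ℕ using (ℕ; zero; suc; pred; _+_; _≤_; _<_; z≤n; s≤s; z<s; parity)
open import Data.Nat.Divisibility using (_∣_; divides; _∣0; ∣-refl; ∣m∣n⇒∣m+n)
import Data.Nat.Properties as ℕₚ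
open import Data.Parity.Base as ℙ using (Parity; 0ℙ; 1ℙ)
import Data.Parity.Properties as ℙₚ
open import Data.Product using (∃; _×_; _,_; proj₁; proj₂; uncurry)
open import Data.Sum using (_⊎_; inj₁; inj₂)
open import Data.Unit using (⊤; tt)
open import Data.Vec using (Vec; []; lookup; insertAt; removeAt; map)
import Data.Vec.Properties as Vecₚ
open import Data.Vec.Relation.Binary.Pointwise.Extensional using (ext; Pointwise-≡⇒≡)
open import Function using (_∘_; id; _⇔_; mk⇔)
open import Function.Bundles using (Equivalence; Inverse)
import Function.Construct.Composition as Composition
import Function.Construct.Symmetry as Symmetry
open import Relation.Binary.Definitions using (tri<; tri≈; tri>)
open import Relation.Binary.PropositionalEquality
open import Relation.Nullary using (Dec; yes; no; does; ¬_)
open import Relation.Nullary.Decidable using (does-⇔; dec-false; _×-dec_)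
open import Relation.Unary using (Pred; Decidable)

open import Algebra.Properties.CommutativeMonoid.Sum ℕₚ.+-0-commutativeMonoid
  using (sum; sum-cong-≗; sum-permute; sum-replicate-zero)

-- Code n has 1 · 3 · 4 ⋯ (n + 1) = (n + 1)! / 2 elements for n ≥ 1.
Extra : ℕ → Set
Extra zero    = ⊥
Extra (suc _) = ⊤

Step : ℕ → Set
Step m = Fin (suc m) ⊎ Extra m

Code : ℕ → Set
Code zero    = ⊤
Code (suc m) = Step m × Code m

punchIn-mono-< : ∀ {m} (p : Fin (suc m)) {i j : Fin m} → i Fin.< j → punchIn p i Fin.< punchIn p j
punchIn-mono-< p {i} {j} i<j =
  Finₚ.≤∧≢⇒< (Finₚ.punchIn-mono-≤ p i j (ℕₚ.<⇒≤ i<j)) (Finₚ.<⇒≢ i<j ∘ Finₚ.punchIn-injective p i j)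

punchIn-cancel-< : ∀ {m} (p : Fin (suc m)) {i j : Fin m} → punchIn p i Fin.< punchIn p j → i Fin.< j
punchIn-cancel-< p {i} {j} lt =
  Finₚ.≤∧≢⇒< (Finₚ.punchIn-cancel-≤ p i j (ℕₚ.<⇒≤ lt)) (Finₚ.<⇒≢ lt ∘ cong (punchIn p))

data PunchInView {m} (p : Fin (suc m)) : Fin (suc m) → Set where
  at      : PunchInView p p
  punched : (i : Fin m) → PunchInView p (punchIn p i)

punchInView : ∀ {m} (p i : Fin (suc m)) → PunchInView p i
punchInView p i with p Finₚ.≟ i
... | yes refl = at
... | no  p≢i  = subst (PunchInView p) (Finₚ.punchIn-punchOut p≢i) (punched (punchOut p≢i))

lookup-removeAt : ∀ {a} {A : Set a} {m} (w : Vec A (suc m)) p i →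
                  lookup (removeAt w p) i ≡ lookup w (punchIn p i)
lookup-removeAt w p i =
  trans (cong (lookup (removeAt w p)) (sym (Finₚ.punchOut-punchIn p)))
        (Vecₚ.removeAt-punchOut w (Finₚ.punchInᵢ≢i p i ∘ sym))

lookup-extensionality : ∀ {a} {A : Set a} {n} {u v : Vec A n} → (∀ i → lookup u i ≡ lookup v i) → u ≡ v
lookup-extensionality u≗v = Pointwise-≡⇒≡ (ext u≗v)

-- Inversions

infix 4 _<ᵇ_

_<ᵇ_ : ∀ {n} → Fin n → Fin n → Bool
i <ᵇ j = does (i Fin.<? j)

count : ∀ {n} → (Fin n → Bool) → ℕ
count P = sum λ i → if P i then 1 else 0

count-cong : ∀ {n} {P Q : Fin n → Bool} → (∀ i → P i ≡ Q i) → count P ≡ count Q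
count-cong P≗Q = sum-cong-≗ (cong (λ b → if b then 1 else 0) ∘ P≗Q)

count-permute : ∀ {n} (π : Permutation′ n) (P : Fin n → Bool) → count (P ∘ (π ⟨$⟩ʳ_)) ≡ count P
count-permute π P = sym (sum-permute _ π)

count-<ᵇ : ∀ {n} (t : Fin n) → count (_<ᵇ t) ≡ toℕ t
count-<ᵇ {suc n} zero = sum-replicate-zero n
count-<ᵇ (suc t)       = cong suc (count-<ᵇ t)

<ᵇ-irrefl : ∀ {n} (i : Fin n) → (i <ᵇ i) ≡ false
<ᵇ-irrefl i = dec-false (i Fin.<? i) (Finₚ.<-irrefl refl)

punchIn-<ᵇ : ∀ {n} (v : Fin (suc n)) (i j : Fin n) → (punchIn v i <ᵇ punchIn v j) ≡ (i <ᵇ j)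
punchIn-<ᵇ v i j =
  does-⇔ (mk⇔ (punchIn-cancel-< v) (punchIn-mono-< v)) (punchIn v i Fin.<? punchIn v j) (i Fin.<? j)

length-filter-tabulate : ∀ {a p} {A : Set a} {P : Pred A p} (P? : Decidable P) {n} (f : Fin n → A) →
                         length (filter P? (tabulate f)) ≡ count (does ∘ P? ∘ f)
length-filter-tabulate P? {zero}  f = refl
length-filter-tabulate P? {suc n} f with does (P? (f zero))
... | true  = cong suc (length-filter-tabulate P? (f ∘ suc))
... | false = length-filter-tabulate P? (f ∘ suc)

length-concatMap-tabulate : ∀ {a b} {A : Set a} {B : Set b} (g : A → List B) {n} (f : Fin n → A) →
                            length (concatMap g (tabulate f)) ≡ sum (length ∘ g ∘ f)
length-concatMap-tabulate g {zero}  f = refl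
length-concatMap-tabulate g {suc n} f =
  trans (length-++ (g (f zero))) (cong (length (g (f zero)) +_) (length-concatMap-tabulate g (f ∘ suc)))

inversionCount : ∀ {n} → (Fin n → Fin n) → ℕ
inversionCount f = sum λ i → count λ j → (i <ᵇ j) ∧ (f j <ᵇ f i)

inversions≡inversionCount : ∀ {n} (π : Permutation′ n) → inversions π ≡ inversionCount (π ⟨$⟩ʳ_)
inversions≡inversionCount {n} π =
  trans (length-concatMap-tabulate (λ i → filter (inverted? i) (allFin n)) id)
        (sum-cong-≗ λ i → length-filter-tabulate (inverted? i) id)
  where
  inverted? : ∀ i j → Dec (i Fin.< j × π ⟨$⟩ʳ j Fin.< π ⟨$⟩ʳ i)
  inverted? i j = (i Fin.<? j) ×-dec (π ⟨$⟩ʳ j Fin.<? π ⟨$⟩ʳ i)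

inversionCount-cong : ∀ {n} {f g : Fin n → Fin n} → (∀ i → f i ≡ g i) →
                      inversionCount f ≡ inversionCount g
inversionCount-cong f≗g =
  sum-cong-≗ λ i → count-cong λ j → cong₂ (λ x y → (i <ᵇ j) ∧ (x <ᵇ y)) (f≗g j) (f≗g i)

inversions-remove : ∀ {n} (π : Permutation′ (suc n)) →
                    inversions π ≡ toℕ (π ⟨$⟩ʳ zero) + inversions (remove zero π)
inversions-remove π = begin
  inversions π                     ≡⟨ inversions≡inversionCount π ⟩
  inversionCount (π ⟨$⟩ʳ_)         ≡⟨ cong₂ _+_ firstRow otherRows ⟩
  toℕ v + inversionCount (σ ⟨$⟩ʳ_) ≡⟨ cong (toℕ v +_) (inversions≡inversionCount σ) ⟨
  toℕ v + inversions σ             ∎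
  where
  open ≡-Reasoning
  v = π ⟨$⟩ʳ zero
  σ = remove zero π
  below-v : ∀ j → ((zero <ᵇ j) ∧ (π ⟨$⟩ʳ j <ᵇ v)) ≡ (π ⟨$⟩ʳ j <ᵇ v)
  below-v zero    = sym (<ᵇ-irrefl v)
  below-v (suc j) = refl
  firstRow : count (λ j → (zero <ᵇ j) ∧ (π ⟨$⟩ʳ j <ᵇ v)) ≡ toℕ v
  firstRow = begin
    count (λ j → (zero <ᵇ j) ∧ (π ⟨$⟩ʳ j <ᵇ v)) ≡⟨ count-cong below-v ⟩
    count ((_<ᵇ v) ∘ (π ⟨$⟩ʳ_))                ≡⟨ count-permute π (_<ᵇ v) ⟩
    count (_<ᵇ v)                              ≡⟨ count-<ᵇ v ⟩
    toℕ v                                      ∎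
  otherRows : sum (λ i → count λ j → (suc i <ᵇ j) ∧ (π ⟨$⟩ʳ j <ᵇ π ⟨$⟩ʳ suc i))
            ≡ inversionCount (σ ⟨$⟩ʳ_)
  otherRows = sum-cong-≗ λ i → count-cong λ j →
    cong ((i <ᵇ j) ∧_) (trans (cong₂ _<ᵇ_ (punchIn-permute π zero j) (punchIn-permute π zero i))
                              (punchIn-<ᵇ v (σ ⟨$⟩ʳ j) (σ ⟨$⟩ʳ i)))

-- Even permutations

2∣⇒parity≡0ℙ : ∀ {n} → 2 ∣ n → parity n ≡ 0ℙ
2∣⇒parity≡0ℙ (divides q refl) = trans (ℙₚ.*-homo-* q 2) (ℙₚ.*-zeroʳ (parity q))

parity≡0ℙ⇒2∣ : ∀ n → parity n ≡ 0ℙ → 2 ∣ n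
parity≡0ℙ⇒2∣ zero          _ = 2 ∣0
parity≡0ℙ⇒2∣ (suc (suc n)) e = ∣m∣n⇒∣m+n ∣-refl (parity≡0ℙ⇒2∣ n e)

Fin1-unique : (i j : Fin 1) → i ≡ j
Fin1-unique zero zero = refl

punchOut-cong₂ : ∀ {m} {i i′ j j′ : Fin (suc m)} {i≢j : i ≢ j} {i′≢j′ : i′ ≢ j′} →
                 i ≡ i′ → j ≡ j′ → punchOut i≢j ≡ punchOut i′≢j′
punchOut-cong₂ {i = i} refl = Finₚ.punchOut-cong i

remove-cong : ∀ {m} (i : Fin (suc m)) {π ρ : Permutation′ (suc m)} →
              π Perm.≈ ρ → remove i π Perm.≈ remove i ρ
remove-cong i π≈ρ k = punchOut-cong₂ (π≈ρ i) (π≈ρ (punchIn i k))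

insert-cong : ∀ {m} {j j′ : Fin (suc m)} {π ρ : Permutation′ m} → j ≡ j′ → π Perm.≈ ρ →
              insert zero j π Perm.≈ insert zero j′ ρ
insert-cong j≡j′ π≈ρ zero    = j≡j′
insert-cong j≡j′ π≈ρ (suc k) = cong₂ punchIn j≡j′ (π≈ρ k)

inversions-cong : ∀ {m} {π ρ : Permutation′ m} → π Perm.≈ ρ → inversions π ≡ inversions ρ
inversions-cong {π = π} {ρ} π≈ρ = begin
  inversions π              ≡⟨ inversions≡inversionCount π ⟩
  inversionCount (π ⟨$⟩ʳ_)  ≡⟨ inversionCount-cong π≈ρ ⟩
  inversionCount (ρ ⟨$⟩ʳ_)  ≡⟨ inversions≡inversionCount ρ ⟨
  inversions ρ              ∎
  where open ≡-Reasoning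

parity-inversions-remove : ∀ {m} (π : Permutation′ (suc m)) →
  parity (inversions π) ≡ parity (toℕ (π ⟨$⟩ʳ zero)) ℙ.+ parity (inversions (remove zero π))
parity-inversions-remove π =
  trans (cong parity (inversions-remove π))
        (ℙₚ.+-homo-+ (toℕ (π ⟨$⟩ʳ zero)) (inversions (remove zero π)))

parity-inversions-insert : ∀ {m} (j : Fin (suc m)) (π : Permutation′ m) →
  parity (inversions (insert zero j π)) ≡ parity (toℕ j) ℙ.+ parity (inversions π)
parity-inversions-insert j π =
  trans (parity-inversions-remove (insert zero j π))
        (cong (λ k → parity (toℕ j) ℙ.+ parity k)
              (inversions-cong {π = remove zero (insert zero j π)} {π} (remove-insert zero j π)))

p+[p+q]≡q : ∀ p q → p ℙ.+ (p ℙ.+ q) ≡ q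
p+[p+q]≡q = \\-leftDividesˡ ℙₚ.+-0-group

fromStep : ∀ {m} → Step (suc m) → Fin (suc (suc (suc m)))
fromStep (inj₁ j) = suc j
fromStep (inj₂ _) = zero

toStep : ∀ {m} → Fin (suc (suc (suc m))) → Step (suc m)
toStep zero    = inj₂ tt
toStep (suc j) = inj₁ j

toStep-fromStep : ∀ {m} (s : Step (suc m)) → toStep (fromStep s) ≡ s
toStep-fromStep (inj₁ j)  = refl
toStep-fromStep (inj₂ tt) = refl

fromStep-toStep : ∀ {m} (j : Fin (suc (suc (suc m)))) → fromStep (toStep j) ≡ j
fromStep-toStep zero    = refl
fromStep-toStep (suc j) = refl

fromParity : Parity → Fin 2
fromParity 0ℙ = zero
fromParity 1ℙ = suc zero

parity-fromParity : ∀ p → parity (toℕ (fromParity p)) ≡ p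
parity-fromParity 0ℙ = refl
parity-fromParity 1ℙ = refl

fromParity-parity : ∀ j → fromParity (parity (toℕ j)) ≡ j
fromParity-parity zero       = refl
fromParity-parity (suc zero) = refl

-- On two points toCode records nothing: there the parity determines the permutation.
toCode : ∀ n → Permutation′ (suc (suc n)) → Code (suc n)
toCode zero    π = inj₁ zero , tt
toCode (suc n) π = toStep (π ⟨$⟩ʳ zero) , toCode n (remove zero π)

fromCode : ∀ n → Parity → Code (suc n) → Permutation′ (suc (suc n))
fromCode zero    p _       = insert zero (fromParity p) Perm.id
fromCode (suc n) p (s , c) = insert zero (fromStep s) (fromCode n (parity (toℕ (fromStep s)) ℙ.+ p) c)

toCode-cong : ∀ n {π ρ} → π Perm.≈ ρ → toCode n π ≡ toCode n ρ
toCode-cong zero    π≈ρ = refl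
toCode-cong (suc n) {π} {ρ} π≈ρ =
  cong₂ _,_ (cong toStep (π≈ρ zero)) (toCode-cong n (remove-cong zero {π} {ρ} π≈ρ))

parity-fromCode : ∀ n p c → parity (inversions (fromCode n p c)) ≡ p
parity-fromCode zero p c = begin
  parity (inversions (fromCode zero p c)) ≡⟨ parity-inversions-insert (fromParity p) Perm.id ⟩
  parity (toℕ (fromParity p)) ℙ.+ 0ℙ     ≡⟨ ℙₚ.+-identityʳ _ ⟩
  parity (toℕ (fromParity p))            ≡⟨ parity-fromParity p ⟩
  p                                      ∎
  where open ≡-Reasoning
parity-fromCode (suc n) p (s , c) = begin
  parity (inversions (insert zero j (fromCode n q c))) ≡⟨ parity-inversions-insert j (fromCode n q c) ⟩
  x ℙ.+ parity (inversions (fromCode n q c))          ≡⟨ cong (x ℙ.+_) (parity-fromCode n q c) ⟩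
  x ℙ.+ (x ℙ.+ p)                                     ≡⟨ p+[p+q]≡q x p ⟩
  p                                                   ∎
  where
  open ≡-Reasoning
  j = fromStep s
  x = parity (toℕ j)
  q = x ℙ.+ p

toCode-fromCode : ∀ n p c → toCode n (fromCode n p c) ≡ c
toCode-fromCode zero    p (inj₁ zero , tt) = refl
toCode-fromCode (suc n) p (s , c) =
  cong₂ _,_ (toStep-fromStep s)
            (trans (toCode-cong n {remove zero (insert zero (fromStep s) ρ)}
                                  (remove-insert zero (fromStep s) ρ))
                   (toCode-fromCode n _ c))
  where ρ = fromCode n (parity (toℕ (fromStep s)) ℙ.+ p) c

fromCode-toCode : ∀ n p (π : Permutation′ (suc (suc n))) → parity (inversions π) ≡ p →
                  fromCode n p (toCode n π) Perm.≈ π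
fromCode-toCode zero p π refl k =
  trans (insert-cong image0 (λ i → Fin1-unique _ _) k) (insert-remove zero π k)
  where
  image0 : fromParity (parity (inversions π)) ≡ π ⟨$⟩ʳ zero
  image0 = trans (cong fromParity (trans (parity-inversions-remove π) (ℙₚ.+-identityʳ _)))
                 (fromParity-parity (π ⟨$⟩ʳ zero))
fromCode-toCode (suc n) p π e k =
  trans (insert-cong (fromStep-toStep v) (fromCode-toCode n _ (remove zero π) e′) k)
        (insert-remove zero π k)
  where
  v = π ⟨$⟩ʳ zero
  x = parity (toℕ v)
  r = parity (inversions (remove zero π))
  e′ : r ≡ parity (toℕ (fromStep (toStep v))) ℙ.+ p
  e′ = begin
    r                                        ≡⟨ p+[p+q]≡q x r ⟨
    x ℙ.+ (x ℙ.+ r)                          ≡⟨ cong (x ℙ.+_) (sym (parity-inversions-remove π)) ⟩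
    x ℙ.+ parity (inversions π)              ≡⟨ cong (x ℙ.+_) e ⟩
    x ℙ.+ p                                  ≡⟨ cong (λ j → parity (toℕ j) ℙ.+ p) (fromStep-toStep v) ⟨
    parity (toℕ (fromStep (toStep v))) ℙ.+ p ∎
    where open ≡-Reasoning

Alt′↔Code : ∀ n → Inverse (Alt′ n) (setoid (Code n))
Alt′↔Code zero = record
  { to        = λ _ → tt
  ; from      = λ _ → Perm.id , 2 ∣0
  ; to-cong   = λ _ → refl
  ; from-cong = λ _ _ → refl
  ; inverse   = (λ _ → refl) , (λ _ i → Fin1-unique _ _)
  }
Alt′↔Code (suc n) = record
  { to        = toCode n ∘ proj₁
  ; from      = λ c → fromCode n 0ℙ c , parity≡0ℙ⇒2∣ _ (parity-fromCode n 0ℙ c)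
  ; to-cong   = toCode-cong n
  ; from-cong = λ { refl i → refl }
  ; inverse   = (λ {c} π≈ → trans (toCode-cong n π≈) (toCode-fromCode n 0ℙ c))
              , (λ {π} c≡ i → trans (cong (λ c → fromCode n 0ℙ c ⟨$⟩ʳ i) c≡)
                                    (fromCode-toCode n 0ℙ (proj₁ π) (2∣⇒parity≡0ℙ (proj₂ π)) i))
  }

-- 112-avoiding Cayley permutations

Avoids112 : ∀ {n} → Vec ℕ n → Set
Avoids112 {n} w = ∀ (a b c : Fin n) → a Fin.< b → b Fin.< c →
                  lookup w a ≡ lookup w b → lookup w a < lookup w c → ⊥

-- IsCayley w × Avoids w p112 with the bound max ≤ n dropped (onto⇒max≤length recovers it)
-- and avoidance stated in terms of positions.
record Cayley112 {n} (w : Vec ℕ n) : Set where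
  field
    max     : ℕ
    bounded : ∀ i → 1 ≤ lookup w i × lookup w i ≤ max
    onto    : ∀ j → 1 ≤ j → j ≤ max → ∃ λ i → lookup w i ≡ j
    avoids  : Avoids112 w

  positive : ∀ i → 1 ≤ lookup w i
  positive = proj₁ ∘ bounded

data SameOrder (x y u v : ℕ) : Set where
  both-< : x < y → u < v → SameOrder x y u v
  both-≡ : x ≡ y → u ≡ v → SameOrder x y u v
  both-> : y < x → v < u → SameOrder x y u v

sameOrder⇒⇔ : ∀ {x y u v} → SameOrder x y u v → (x < y ⇔ u < v) × (x ≡ y ⇔ u ≡ v)
sameOrder⇒⇔ (both-< x<y u<v) =
  mk⇔ (λ _ → u<v) (λ _ → x<y) , mk⇔ (⊥-elim ∘ ℕₚ.<⇒≢ x<y) (⊥-elim ∘ ℕₚ.<⇒≢ u<v)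
sameOrder⇒⇔ (both-≡ refl refl) =
  mk⇔ (⊥-elim ∘ ℕₚ.<-irrefl refl) (⊥-elim ∘ ℕₚ.<-irrefl refl) , mk⇔ (λ _ → refl) (λ _ → refl)
sameOrder⇒⇔ (both-> y<x v<u) =
  mk⇔ (⊥-elim ∘ ℕₚ.<-asym y<x) (⊥-elim ∘ ℕₚ.<-asym v<u) ,
  mk⇔ (⊥-elim ∘ ℕₚ.>⇒≢ y<x) (⊥-elim ∘ ℕₚ.>⇒≢ v<u)

Avoids112⇒Avoids : ∀ {n} (w : Vec ℕ n) → Avoids112 w → Avoids w p112
Avoids112⇒Avoids w avoids (f , increasing , iso) =
  avoids (f zero) (f (suc zero)) (f (suc (suc zero)))
    (increasing zero (suc zero) z<s) (increasing (suc zero) (suc (suc zero)) (s≤s z<s))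
    (Equivalence.from (proj₂ (iso zero (suc zero))) refl)
    (Equivalence.from (proj₁ (iso zero (suc (suc zero)))) (s≤s (s≤s z≤n)))

Avoids⇒Avoids112 : ∀ {n} (w : Vec ℕ n) → Avoids w p112 → Avoids112 w
Avoids⇒Avoids112 {n} w avoids a b c a<b b<c wa≡wb wa<wc =
  avoids (f , increasing , λ x y → sameOrder⇒⇔ (sameOrder x y))
  where
  f : Fin 3 → Fin n
  f zero             = a
  f (suc zero)       = b
  f (suc (suc zero)) = c

  increasing : ∀ x y → x Fin.< y → f x Fin.< f y
  increasing zero             (suc zero)       _ = a<b
  increasing zero             (suc (suc zero)) _ = Finₚ.<-trans a<b b<c
  increasing (suc zero)       (suc (suc zero)) _ = b<c
  increasing zero             zero             ()
  increasing (suc zero)       zero             ()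
  increasing (suc zero)       (suc zero)       (s≤s ())
  increasing (suc (suc zero)) zero             ()
  increasing (suc (suc zero)) (suc zero)       (s≤s ())
  increasing (suc (suc zero)) (suc (suc zero)) (s≤s (s≤s ()))

  wb<wc : lookup w b < lookup w c
  wb<wc = subst (_< lookup w c) wa≡wb wa<wc

  1<2 : 1 < 2
  1<2 = s≤s (s≤s z≤n)

  sameOrder : ∀ x y → SameOrder (lookup w (f x)) (lookup w (f y)) (lookup p112 x) (lookup p112 y)
  sameOrder zero             zero             = both-≡ refl refl
  sameOrder zero             (suc zero)       = both-≡ wa≡wb refl
  sameOrder zero             (suc (suc zero)) = both-< wa<wc 1<2
  sameOrder (suc zero)       zero             = both-≡ (sym wa≡wb) refl
  sameOrder (suc zero)       (suc zero)       = both-≡ refl refl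
  sameOrder (suc zero)       (suc (suc zero)) = both-< wb<wc 1<2
  sameOrder (suc (suc zero)) zero             = both-> wa<wc 1<2
  sameOrder (suc (suc zero)) (suc zero)       = both-> wb<wc 1<2
  sameOrder (suc (suc zero)) (suc (suc zero)) = both-≡ refl refl

onto⇒max≤length : ∀ {n} (w : Vec ℕ n) k → (∀ j → 1 ≤ j → j ≤ k → ∃ λ i → lookup w i ≡ j) → k ≤ n
onto⇒max≤length {n} w k onto = ℕₚ.≮⇒≥ λ n<k →
  let i , j , i<j , same = Finₚ.pigeonhole n<k position in
  ℕₚ.<-irrefl (ℕₚ.suc-injective (begin
    suc (toℕ i)           ≡⟨ hit i ⟨
    lookup w (position i) ≡⟨ cong (lookup w) same ⟩
    lookup w (position j) ≡⟨ hit j ⟩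
    suc (toℕ j)           ∎)) i<j
  where
  open ≡-Reasoning
  position : Fin k → Fin n
  position j = proj₁ (onto (suc (toℕ j)) (s≤s z≤n) (Finₚ.toℕ<n j))
  hit : ∀ j → lookup w (position j) ≡ suc (toℕ j)
  hit j = proj₂ (onto (suc (toℕ j)) (s≤s z≤n) (Finₚ.toℕ<n j))

Cayley112⇔ : ∀ {n} (w : Vec ℕ n) → (IsCayley w × Avoids w p112) ⇔ Cayley112 w
Cayley112⇔ w = mk⇔ (λ ((k , _ , bounded , onto) , avoids) → record
                      { max = k ; bounded = bounded ; onto = onto ; avoids = Avoids⇒Avoids112 w avoids })
                   (λ c → let open Cayley112 c in
                      (max , onto⇒max≤length w max onto , bounded , onto) , Avoids112⇒Avoids w avoids)

1≤max : ∀ {m} {w : Vec ℕ (suc m)} (c : Cayley112 w) → 1 ≤ Cayley112.max c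
1≤max c = ℕₚ.≤-trans (positive zero) (proj₂ (bounded zero))
  where open Cayley112 c

contains1 : ∀ {m} {w : Vec ℕ (suc m)} → Cayley112 w → ∃ λ i → lookup w i ≡ 1
contains1 c = Cayley112.onto c 1 (s≤s z≤n) (1≤max c)

extend : ∀ {m} → Step m → Vec ℕ m → Vec ℕ (suc m)
extend     (inj₁ p) u = insertAt (map suc u) p 1
extend {m} (inj₂ _) u = insertAt u (fromℕ m) 1

lookup-insertOne : ∀ {m} (u : Vec ℕ m) p i →
                   lookup (insertAt (map suc u) p 1) (punchIn p i) ≡ suc (lookup u i)
lookup-insertOne u p i = trans (Vecₚ.insertAt-punchIn (map suc u) p 1 i) (Vecₚ.lookup-map i suc u)

insertOne-cayley112 : ∀ {m} {u : Vec ℕ m} p → Cayley112 u → Cayley112 (insertAt (map suc u) p 1)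
insertOne-cayley112 {u = u} p c = record
  { max = suc max ; bounded = bounded′ ; onto = onto′ ; avoids = avoids′ }
  where
  open Cayley112 c
  w = insertAt (map suc u) p 1
  w[p]≡1 : lookup w p ≡ 1
  w[p]≡1 = Vecₚ.insertAt-lookup (map suc u) p 1
  w[i]≡1+u : ∀ i → lookup w (punchIn p i) ≡ suc (lookup u i)
  w[i]≡1+u = lookup-insertOne u p

  bounded′ : ∀ i → 1 ≤ lookup w i × lookup w i ≤ suc max
  bounded′ i with punchInView p i
  ... | at rewrite w[p]≡1 = s≤s z≤n , s≤s z≤n
  ... | punched i rewrite w[i]≡1+u i = s≤s z≤n , s≤s (proj₂ (bounded i))

  onto′ : ∀ j → 1 ≤ j → j ≤ suc max → ∃ λ i → lookup w i ≡ j
  onto′ (suc zero)    _ _         = p , w[p]≡1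
  onto′ (suc (suc j)) _ (s≤s j<) =
    let i , u[i]≡ = onto (suc j) (s≤s z≤n) j< in punchIn p i , trans (w[i]≡1+u i) (cong suc u[i]≡)

  avoids′ : Avoids112 w
  avoids′ a b c a<b b<c wa≡wb wa<wc with punchInView p a | punchInView p b | punchInView p c
  ... | at | at | _ = Finₚ.<-irrefl refl a<b
  ... | at | punched b | _ =
    ℕₚ.n>0⇒n≢0 (positive b) (sym (ℕₚ.suc-injective (trans (sym w[p]≡1) (trans wa≡wb (w[i]≡1+u b)))))
  ... | punched a | at | _ =
    ℕₚ.n>0⇒n≢0 (positive a) (ℕₚ.suc-injective (trans (sym (w[i]≡1+u a)) (trans wa≡wb w[p]≡1)))
  ... | punched a | punched b | at =
    ℕₚ.n≮0 (ℕ.s<s⁻¹ (subst₂ _<_ (w[i]≡1+u a) w[p]≡1 wa<wc))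
  ... | punched a | punched b | punched c =
    avoids a b c (punchIn-cancel-< p a<b) (punchIn-cancel-< p b<c)
      (ℕₚ.suc-injective (trans (sym (w[i]≡1+u a)) (trans wa≡wb (w[i]≡1+u b))))
      (ℕ.s<s⁻¹ (subst₂ _<_ (w[i]≡1+u a) (w[i]≡1+u c) wa<wc))

append1-cayley112 : ∀ {m} {u : Vec ℕ (suc m)} → Cayley112 u →
                    Cayley112 (insertAt u (fromℕ (suc m)) 1)
append1-cayley112 {m} {u} c = record
  { max = max ; bounded = bounded′ ; onto = onto′ ; avoids = avoids′ }
  where
  open Cayley112 c
  end = fromℕ (suc m)
  w = insertAt u end 1
  w[end]≡1 : lookup w end ≡ 1
  w[end]≡1 = Vecₚ.insertAt-lookup u end 1
  w[i]≡u : ∀ i → lookup w (punchIn end i) ≡ lookup u i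
  w[i]≡u = Vecₚ.insertAt-punchIn u end 1

  bounded′ : ∀ i → 1 ≤ lookup w i × lookup w i ≤ max
  bounded′ i with punchInView end i
  ... | at rewrite w[end]≡1 = s≤s z≤n , 1≤max c
  ... | punched i rewrite w[i]≡u i = bounded i

  onto′ : ∀ j → 1 ≤ j → j ≤ max → ∃ λ i → lookup w i ≡ j
  onto′ j 1≤j j≤max = let i , u[i]≡j = onto j 1≤j j≤max in punchIn end i , trans (w[i]≡u i) u[i]≡j

  avoids′ : Avoids112 w
  avoids′ a b c a<b b<c wa≡wb wa<wc with punchInView end a | punchInView end b | punchInView end c
  ... | _ | _ | at =
    ℕₚ.<-irrefl refl (ℕₚ.<-≤-trans (subst (lookup w a <_) w[end]≡1 wa<wc) (proj₁ (bounded′ a)))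
  ... | _ | at | punched c = ℕₚ.<-irrefl refl (ℕₚ.<-≤-trans b<c (Finₚ.≤fromℕ (punchIn end c)))
  ... | at | punched b | punched c = ℕₚ.<-irrefl refl (ℕₚ.<-≤-trans a<b (Finₚ.≤fromℕ (punchIn end b)))
  ... | punched a | punched b | punched c =
    avoids a b c (punchIn-cancel-< end a<b) (punchIn-cancel-< end b<c)
      (trans (sym (w[i]≡u a)) (trans wa≡wb (w[i]≡u b)))
      (subst₂ _<_ (w[i]≡u a) (w[i]≡u c) wa<wc)

extend-cayley112 : ∀ {m} (s : Step m) {u : Vec ℕ m} → Cayley112 u → Cayley112 (extend s u)
extend-cayley112 {m}     (inj₁ p) = insertOne-cayley112 p
extend-cayley112 {suc m} (inj₂ _) = append1-cayley112

removeAt-avoids112 : ∀ {m} (w : Vec ℕ (suc m)) p → Avoids112 w → Avoids112 (removeAt w p)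
removeAt-avoids112 w p avoids a b c a<b b<c wa≡wb wa<wc =
  avoids (punchIn p a) (punchIn p b) (punchIn p c) (punchIn-mono-< p a<b) (punchIn-mono-< p b<c)
    (trans (sym (lookup-removeAt w p a)) (trans wa≡wb (lookup-removeAt w p b)))
    (subst₂ _<_ (lookup-removeAt w p a) (lookup-removeAt w p c) wa<wc)

map-pred-avoids112 : ∀ {m} (v : Vec ℕ m) → (∀ i → 1 ≤ lookup v i) → Avoids112 v →
                     Avoids112 (map pred v)
map-pred-avoids112 v positive avoids a b c a<b b<c wa≡wb wa<wc =
  avoids a b c a<b b<c
    (ℕₚ.pred-injective {{ℕ.>-nonZero (positive a)}} {{ℕ.>-nonZero (positive b)}}
      (subst₂ _≡_ (lookup-map a) (lookup-map b) wa≡wb))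
    (ℕₚ.pred-cancel-< (subst₂ _<_ (lookup-map a) (lookup-map c) wa<wc))
  where
  lookup-map : ∀ i → lookup (map pred v) i ≡ pred (lookup v i)
  lookup-map i = Vecₚ.lookup-map i pred v

find1? : ∀ {m} (w : Vec ℕ m) → Dec (∃ λ i → lookup w i ≡ 1)
find1? w = Finₚ.any? (λ i → lookup w i ℕ.≟ 1)

EndsInRepeated1 : ∀ {m} → Vec ℕ (suc m) → Set
EndsInRepeated1 {m} w = lookup w (fromℕ m) ≡ 1 × ∃ λ i → lookup (removeAt w (fromℕ m)) i ≡ 1

endsInRepeated1? : ∀ {m} (w : Vec ℕ (suc m)) → Dec (EndsInRepeated1 w)
endsInRepeated1? {m} w =
  (lookup w (fromℕ m) ℕ.≟ 1) ×-dec find1? (removeAt w (fromℕ m))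

extra : ∀ {m} → Fin m → Extra m
extra {suc m} _ = tt

shrink : ∀ {m} → Vec ℕ (suc m) → Step m × Vec ℕ m
shrink {m} w with endsInRepeated1? w | find1? w
... | yes (_ , i , _) | _           = inj₂ (extra i) , removeAt w (fromℕ m)
... | no _            | yes (p , _) = inj₁ p , map pred (removeAt w p)
... | no _            | no _        = inj₁ zero , removeAt w zero  -- unreachable: Cayley words contain 1

-- After a second 1 no larger letter may follow, so the last letter is 1 as well.
two-1s⇒endsInRepeated1 : ∀ {m} {w : Vec ℕ (suc m)} → Cayley112 w →
                         ∀ {a b} → a Fin.< b → lookup w a ≡ 1 → lookup w b ≡ 1 → EndsInRepeated1 w
two-1s⇒endsInRepeated1 {m} {w} c {a} {b} a<b wa≡1 wb≡1
  with punchInView (fromℕ m) b | punchInView (fromℕ m) a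
... | at        | at        = ⊥-elim (Finₚ.<-irrefl refl a<b)
... | at        | punched a = wb≡1 , a , trans (lookup-removeAt w (fromℕ m) a) wa≡1
... | punched b | _ with lookup w (fromℕ m) ℕ.≟ 1
...   | yes wend≡1 = wend≡1 , b , trans (lookup-removeAt w (fromℕ m) b) wb≡1
...   | no  wend≢1 = ⊥-elim (avoids _ _ end a<b b<end (trans wa≡1 (sym wb≡1)) 1<wend)
  where
  open Cayley112 c
  end = fromℕ m
  b<end : punchIn end b Fin.< end
  b<end = Finₚ.≤∧≢⇒< (Finₚ.≤fromℕ _) (Finₚ.punchInᵢ≢i end b)
  1<wend : lookup w a < lookup w end
  1<wend = subst (_< lookup w end) (sym wa≡1) (ℕₚ.≤∧≢⇒< (positive end) (wend≢1 ∘ sym))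

1-unique : ∀ {m} {w : Vec ℕ (suc m)} → Cayley112 w → ¬ EndsInRepeated1 w →
           ∀ {a b} → lookup w a ≡ 1 → lookup w b ≡ 1 → a ≡ b
1-unique c ¬ends {a} {b} wa≡1 wb≡1 with Finₚ.<-cmp a b
... | tri< a<b _ _ = ⊥-elim (¬ends (two-1s⇒endsInRepeated1 c a<b wa≡1 wb≡1))
... | tri≈ _ a≡b _ = a≡b
... | tri> _ _ b<a = ⊥-elim (¬ends (two-1s⇒endsInRepeated1 c b<a wb≡1 wa≡1))

removeLast-cayley112 : ∀ {m} {w : Vec ℕ (suc m)} → Cayley112 w → EndsInRepeated1 w →
                       Cayley112 (removeAt w (fromℕ m))
removeLast-cayley112 {m} {w} c (wend≡1 , i₁ , v[i₁]≡1) = record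
  { max = max ; bounded = bounded′ ; onto = onto′ ; avoids = removeAt-avoids112 w end avoids }
  where
  open Cayley112 c
  end = fromℕ m
  v = removeAt w end
  bounded′ : ∀ i → 1 ≤ lookup v i × lookup v i ≤ max
  bounded′ i rewrite lookup-removeAt w end i = bounded (punchIn end i)
  onto′ : ∀ j → 1 ≤ j → j ≤ max → ∃ λ i → lookup v i ≡ j
  onto′ j 1≤j j≤max with onto j 1≤j j≤max
  ... | i , w[i]≡j with punchInView end i
  ...   | at        = i₁ , trans v[i₁]≡1 (trans (sym wend≡1) w[i]≡j)
  ...   | punched i = i , trans (lookup-removeAt w end i) w[i]≡j

removeUnique1-cayley112 : ∀ {m} {w : Vec ℕ (suc m)} {p} → Cayley112 w → lookup w p ≡ 1 →
                          (∀ i → lookup w i ≡ 1 → i ≡ p) → Cayley112 (map pred (removeAt w p))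
removeUnique1-cayley112 {m} {w} {p} c w[p]≡1 only-p = record
  { max = pred max ; bounded = bounded′ ; onto = onto′
  ; avoids = map-pred-avoids112 (removeAt w p) positive′ (removeAt-avoids112 w p avoids) }
  where
  open Cayley112 c
  v = map pred (removeAt w p)
  v[i] : ∀ i → lookup v i ≡ pred (lookup w (punchIn p i))
  v[i] i = trans (Vecₚ.lookup-map i pred (removeAt w p)) (cong pred (lookup-removeAt w p i))
  ≥2 : ∀ i → 2 ≤ lookup w (punchIn p i)
  ≥2 i = ℕₚ.≤∧≢⇒< (positive (punchIn p i)) (Finₚ.punchInᵢ≢i p i ∘ only-p (punchIn p i) ∘ sym)
  positive′ : ∀ i → 1 ≤ lookup (removeAt w p) i
  positive′ i rewrite lookup-removeAt w p i = ℕₚ.<⇒≤ (≥2 i)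
  bounded′ : ∀ i → 1 ≤ lookup v i × lookup v i ≤ pred max
  bounded′ i rewrite v[i] i = ℕₚ.pred-mono-≤ (≥2 i) , ℕₚ.pred-mono-≤ (proj₂ (bounded (punchIn p i)))
  onto′ : ∀ j → 1 ≤ j → j ≤ pred max → ∃ λ i → lookup v i ≡ j
  onto′ j 1≤j j≤pred
    with onto (suc j) (s≤s z≤n) (ℕₚ.m≤pred[n]⇒suc[m]≤n {{ℕ.>-nonZero (1≤max c)}} j≤pred)
  ... | i , w[i]≡1+j with punchInView p i
  ...   | at        = ⊥-elim (ℕₚ.n>0⇒n≢0 1≤j (ℕₚ.suc-injective (trans (sym w[i]≡1+j) w[p]≡1)))
  ...   | punched i = i , trans (v[i] i) (cong pred w[i]≡1+j)

map-pred∘map-suc : ∀ {m} (u : Vec ℕ m) → map pred (map suc u) ≡ u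
map-pred∘map-suc u = trans (sym (Vecₚ.map-∘ pred suc u)) (Vecₚ.map-id u)

insertOne-1-only-at : ∀ {m} {u : Vec ℕ m} p → (∀ i → 1 ≤ lookup u i) →
                      ∀ i → lookup (insertAt (map suc u) p 1) i ≡ 1 → i ≡ p
insertOne-1-only-at {u = u} p positive i w[i]≡1 with punchInView p i
... | at        = refl
... | punched i =
  ⊥-elim (ℕₚ.n>0⇒n≢0 (positive i) (ℕₚ.suc-injective (trans (sym (lookup-insertOne u p i)) w[i]≡1)))

shrink-insertOne : ∀ {m} {u : Vec ℕ m} p → (∀ i → 1 ≤ lookup u i) →
                   shrink (insertAt (map suc u) p 1) ≡ (inj₁ p , u)
shrink-insertOne {m} {u} p positive
  with endsInRepeated1? (insertAt (map suc u) p 1) | find1? (insertAt (map suc u) p 1)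
... | yes (wend≡1 , i , v[i]≡1) | _ =
  ⊥-elim (Finₚ.punchInᵢ≢i (fromℕ m) i (trans (only-p _ w[i]≡1) (sym (only-p _ wend≡1))))
  where
  only-p = insertOne-1-only-at p positive
  w[i]≡1 : lookup (insertAt (map suc u) p 1) (punchIn (fromℕ m) i) ≡ 1
  w[i]≡1 = trans (sym (lookup-removeAt (insertAt (map suc u) p 1) (fromℕ m) i)) v[i]≡1
... | no _ | yes (q , w[q]≡1) rewrite insertOne-1-only-at p positive q w[q]≡1 =
  cong (inj₁ p ,_) (trans (cong (map pred) (Vecₚ.removeAt-insertAt (map suc u) p 1))
                          (map-pred∘map-suc u))
... | no _ | no no1 = ⊥-elim (no1 (p , Vecₚ.insertAt-lookup (map suc u) p 1))

shrink-append1 : ∀ {m} {u : Vec ℕ (suc m)} → Cayley112 u →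
                 shrink (insertAt u (fromℕ (suc m)) 1) ≡ (inj₂ tt , u)
shrink-append1 {m} {u} c
  with endsInRepeated1? (insertAt u (fromℕ (suc m)) 1) | find1? (insertAt u (fromℕ (suc m)) 1)
... | yes _    | _ = cong (inj₂ tt ,_) (Vecₚ.removeAt-insertAt u (fromℕ (suc m)) 1)
... | no ¬ends | _ = ⊥-elim (¬ends (Vecₚ.insertAt-lookup u (fromℕ (suc m)) 1 , i , v[i]≡1))
  where
  i = proj₁ (contains1 c)
  v[i]≡1 : lookup (removeAt (insertAt u (fromℕ (suc m)) 1) (fromℕ (suc m))) i ≡ 1
  v[i]≡1 = trans (cong (λ v → lookup v i) (Vecₚ.removeAt-insertAt u (fromℕ (suc m)) 1))
                 (proj₂ (contains1 c))

shrink-extend : ∀ {m} (s : Step m) {u : Vec ℕ m} → Cayley112 u → shrink (extend s u) ≡ (s , u)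
shrink-extend         (inj₁ p) c = shrink-insertOne p (Cayley112.positive c)
shrink-extend {suc m} (inj₂ _) c = shrink-append1 c

extend-shrink : ∀ {m} {w : Vec ℕ (suc m)} → Cayley112 w → uncurry extend (shrink w) ≡ w
extend-shrink {m} {w} c with endsInRepeated1? w | find1? w
... | yes (wend≡1 , _) | _ =
  trans (cong (insertAt (removeAt w (fromℕ m)) (fromℕ m)) (sym wend≡1))
        (Vecₚ.insertAt-removeAt w (fromℕ m))
... | no _ | yes (p , w[p]≡1) = lookup-extensionality agree
  where
  open Cayley112 c
  v = map pred (removeAt w p)
  agree : ∀ i → lookup (insertAt (map suc v) p 1) i ≡ lookup w i
  agree i with punchInView p i
  ... | at        = trans (Vecₚ.insertAt-lookup (map suc v) p 1) (sym w[p]≡1)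
  ... | punched i = begin
    lookup (insertAt (map suc v) p 1) (punchIn p i) ≡⟨ lookup-insertOne v p i ⟩
    suc (lookup v i)                               ≡⟨ cong suc (Vecₚ.lookup-map i pred (removeAt w p)) ⟩
    suc (pred (lookup (removeAt w p) i))           ≡⟨ cong (ℕ.suc ∘ pred) (lookup-removeAt w p i) ⟩
    suc (pred (lookup w (punchIn p i)))            ≡⟨ ℕₚ.suc-pred _ {{ℕ.>-nonZero (positive (punchIn p i))}} ⟩
    lookup w (punchIn p i)                         ∎
    where open ≡-Reasoning
... | no _ | no no1 = ⊥-elim (no1 (contains1 c))

shrink-cayley112 : ∀ {m} {w : Vec ℕ (suc m)} → Cayley112 w → Cayley112 (proj₂ (shrink w))
shrink-cayley112 {w = w} c with endsInRepeated1? w | find1? w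
... | yes ends | _ = removeLast-cayley112 c ends
... | no ¬ends | yes (p , w[p]≡1) =
  removeUnique1-cayley112 c w[p]≡1 (λ i w[i]≡1 → 1-unique c ¬ends w[i]≡1 w[p]≡1)
... | no _ | no no1 = ⊥-elim (no1 (contains1 c))

word : ∀ n → Code n → Vec ℕ n
word zero    _       = []
word (suc m) (s , c) = extend s (word m c)

code : ∀ n → Vec ℕ n → Code n
code zero    _ = tt
code (suc m) w = proj₁ (shrink w) , code m (proj₂ (shrink w))

word-cayley112 : ∀ n c → Cayley112 (word n c)
word-cayley112 zero    _       =
  record { max = 0 ; bounded = λ () ; onto = λ { (suc _) _ () } ; avoids = λ () }
word-cayley112 (suc m) (s , c) = extend-cayley112 s (word-cayley112 m c)

code-word : ∀ n c → code n (word n c) ≡ c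
code-word zero    tt      = refl
code-word (suc m) (s , c) rewrite shrink-extend s (word-cayley112 m c) = cong (s ,_) (code-word m c)

word-code : ∀ n (w : Vec ℕ n) → Cayley112 w → word n (code n w) ≡ w
word-code zero    [] _  = refl
word-code (suc m) w  cw =
  trans (cong (extend (proj₁ (shrink w))) (word-code m _ (shrink-cayley112 cw))) (extend-shrink cw)

Cay↔Code : ∀ n → Inverse (Cay p112 n) (setoid (Code n))
Cay↔Code n = record
  { to        = code n ∘ proj₁
  ; from      = λ c → word n c , Equivalence.from (Cayley112⇔ (word n c)) (word-cayley112 n c)
  ; to-cong   = cong (code n)
  ; from-cong = cong (word n)
  ; inverse   = (λ {c} w≡ → trans (cong (code n) w≡) (code-word n c))
              , (λ {w} c≡ → trans (cong (word n) c≡)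
                                  (word-code n (proj₁ w) (Equivalence.to (Cayley112⇔ (proj₁ w)) (proj₂ w))))
  }

theorem6p2 : (n : ℕ) → Inverse (Cay p112 n) (Alt′ n)
theorem6p2 n = Composition.inverse (Cay↔Code n) (Symmetry.inverse (Alt′↔Code n))
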